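{- For every $n\geq 2$, $\kappa^s(BH_n;K_{1,1})=2n$.
   Context: The $n$-dimensional balanced hypercube $BH_n$ is the graph with vertex set $\{0,1,2,3\}^n$, vertices written $(a_0,a_1,\dots,a_{n-1})$, in which $(a_0,\dots,a_{n-1})$ is adjacent exactly to the $2n$ vertices $((a_0\pm 1)\bmod 4,a_1,\dots,a_{n-1})$ and, for each $1\le i\le n-1$, $((a_0\pm1)\bmod 4,a_1,\dots,a_{i-1},(a_i+(-1)^{a_0})\bmod 4,a_{i+1},\dots,a_{n-1})$. For a connected graph $G$ and a set $F$ of connected subgraphs of $G$, let $V(F)$ be the union of their vertex sets; $F$ is a subgraph-cut if $G-V(F)$ is disconnected or trivial. For a connected subgraph $H$ of $G$, an $H$-substructure-cut is a subgraph-cut each of whose elements is isomorphic to a connected subgraph of $H$, and $\kappa^s(G;H)$ is the minimum cardinality of an $H$-substructure-cut. $K_{1,1}$ is the graph consisting of a single edge. -}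

module Defs where

open import Data.Nat using (ℕ; zero; suc; _*_; _≤_)
open import Data.Fin using (Fin; zero; suc)
open import Data.Vec using (Vec; []; _∷_; updateAt)
open import Data.List using (List; length)
open import Data.List.Relation.Unary.Any using (Any)
open import Data.List.Relation.Unary.AllPairs using (AllPairs)
open import Data.Product using (Σ; _×_; ∃)
open import Data.Sum using (_⊎_)
open import Relation.Binary.PropositionalEquality using (_≡_)
open import Relation.Nullary using (¬_)
open import Function.Bundles using (_⇔_)

inc4 : Fin 4 → Fin 4
inc4 zero = suc zero
inc4 (suc zero) = suc (suc zero)
inc4 (suc (suc zero)) = suc (suc (suc zero))
inc4 (suc (suc (suc zero))) = zero

dec4 : Fin 4 → Fin 4
dec4 zero = suc (suc (suc zero))
dec4 (suc zero) = zero
dec4 (suc (suc zero)) = suc zero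
dec4 (suc (suc (suc zero))) = suc (suc zero)

-- x ↦ (x + (-1)^a) mod 4
signStep : Fin 4 → Fin 4 → Fin 4
signStep zero = inc4
signStep (suc zero) = dec4
signStep (suc (suc zero)) = inc4
signStep (suc (suc (suc zero))) = dec4

Vtx : ℕ → Set
Vtx n = Vec (Fin 4) n

BHAdj : {n : ℕ} → Vtx n → Vtx n → Set
BHAdj {zero} _ _ = Data.Empty.⊥
  where import Data.Empty
BHAdj {suc m} (a₀ ∷ as) (b₀ ∷ bs) =
  (b₀ ≡ inc4 a₀ ⊎ b₀ ≡ dec4 a₀)
  × (bs ≡ as ⊎ Σ (Fin m) (λ i → bs ≡ updateAt as i (signStep a₀)))

-- connected subgraphs of BH_n isomorphic to a connected subgraph of K_{1,1}:
-- a single vertex (K_1) or a single edge (K_{1,1})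
data Piece (n : ℕ) : Set where
  vtx : Vtx n → Piece n
  edg : (u v : Vtx n) → BHAdj u v → Piece n

_∈P_ : {n : ℕ} → Vtx n → Piece n → Set
x ∈P vtx v = x ≡ v
x ∈P edg u v _ = x ≡ u ⊎ x ≡ v

-- two pieces are the same subgraph iff they have the same vertex set
-- (a subgraph with two vertices from a simple graph is the edge between them)
SamePiece : {n : ℕ} → Piece n → Piece n → Set
SamePiece p q = ∀ x → (x ∈P p) ⇔ (x ∈P q)

-- a set F of such subgraphs, given as a duplicate-free list
Distinct : {n : ℕ} → List (Piece n) → Set
Distinct = AllPairs (λ p q → ¬ SamePiece p q)

InVF : {n : ℕ} → List (Piece n) → Vtx n → Set
InVF F x = Any (x ∈P_) F

Remains : {n : ℕ} → List (Piece n) → Vtx n → Set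
Remains F x = ¬ InVF F x

data Path {n : ℕ} (F : List (Piece n)) : Vtx n → Vtx n → Set where
  here : ∀ {x} → Remains F x → Path F x x
  step : ∀ {x y z} → Remains F x → BHAdj x y → Path F y z → Path F x z

IsCut : {n : ℕ} → List (Piece n) → Set
IsCut F =
  (∀ x y → Remains F x → Remains F y → x ≡ y)
  ⊎ Σ _ (λ x → Σ _ (λ y → Remains F x × Remains F y × ¬ Path F x y))

IsK11Cut : {n : ℕ} → List (Piece n) → Set
IsK11Cut F = Distinct F × IsCut F

KappaS-K11 : (n k : ℕ) → Set
KappaS-K11 n k =
  Σ (List (Piece n)) (λ F → IsK11Cut F × length F ≡ k)
  × (∀ (F : List (Piece n)) → IsK11Cut F → k ≤ length F)

module Submission where

-- Write n = m + 1.  A vertex a₀ ∷ x of BH_n is determined by its class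
-- (parity of a₀ , x) together with the bit a₀ ≥ 2, and two vertices are adjacent
-- exactly when their classes are adjacent in the bipartite class graph Q_m on
-- Bool × Z₄^m, where (false , x) ~ (true , y) iff y = x or y = x + eᵢ.  So BH_n
-- is Q_m with every vertex doubled, and every class has m + 1 pairwise
-- independent neighbours.
--
-- Upper bound: the 2n twins of the neighbours of one class, taken as single
-- vertices, cut off the two twins of that class.
-- Lower bound: call a class alive if one of its twins survives F.  The core
-- lemma connects-or-obstructs, proved by induction on m after splitting Q_{m+1}
-- into four copies of Q_m joined by perfect matchings, says that two alive
-- classes are joined by alive classes unless m + 1 pairwise independent classes
-- are dead.  The 2(m + 1) twins of those classes lie in V(F) and no piece
-- contains two of them, so |F| ≥ 2n; otherwise alive paths of classes lift to
-- paths of BH_n - V(F), so F is not a cut.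

open import Defs
open import Data.Nat using (ℕ; zero; suc; _≤_; _<_; z≤n; s≤s; _*_; _≤?_)
open import Data.Nat.Properties using (≤-refl; ≤-trans; ≤-reflexive; ≰⇒>; <⇒≱; *-suc; *-monoʳ-≤)
open import Data.Fin using (Fin; zero; suc)
open import Data.Fin.Properties using () renaming (_≟_ to _≟ᶠ_)
open import Data.Bool using (Bool; true; false)
open import Data.Vec using (Vec; []; _∷_; updateAt; replicate; head)
open import Data.Vec.Properties using (∷-injectiveˡ; ∷-injectiveʳ; ≡-dec; updateAt-updateAt-local; updateAt-id)
open import Data.List using (List; []; _∷_; length; map; tabulate)
open import Data.List.Properties using (length-map; length-tabulate; length-removeAt′)
open import Data.List.Membership.Propositional using (_∈_)
open import Data.List.Membership.Propositional.Properties using (∈-tabulate⁺)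
open import Data.List.Relation.Unary.Any as Any using (Any; here; there; any?; index; _─_)
import Data.List.Relation.Unary.Any.Properties as Anyₚ
open import Data.List.Relation.Unary.All as All using (All; []; _∷_)
import Data.List.Relation.Unary.All.Properties as Allₚ
open import Data.List.Relation.Unary.AllPairs as AllPairs using (AllPairs; []; _∷_)
import Data.List.Relation.Unary.AllPairs.Properties as AllPairsₚ
open import Data.List.Relation.Unary.Unique.Propositional using (Unique)
open import Data.Product using (Σ; _×_; _,_; proj₁; proj₂)
open import Data.Sum using (_⊎_; inj₁; inj₂; [_,_]′; map₂)
open import Data.Empty using (⊥; ⊥-elim)
open import Function using (_∘_; id)
open import Function.Bundles using (Equivalence)
open import Level using (0ℓ)
open import Effect.Monad using (RawMonad)
import Data.Sum.Effectful.Right as SumRight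
open import Relation.Binary.PropositionalEquality using (_≡_; refl; sym; trans; cong; subst; subst₂; _≢_)
open import Relation.Nullary using (¬_; Dec; yes; no)
open import Relation.Nullary.Decidable using (_⊎-dec_; ¬?; map′; decidable-stable)
open import Relation.Unary using (Decidable)

dec-inc : ∀ a → dec4 (inc4 a) ≡ a
dec-inc zero = refl
dec-inc (suc zero) = refl
dec-inc (suc (suc zero)) = refl
dec-inc (suc (suc (suc zero))) = refl

inc-dec : ∀ a → inc4 (dec4 a) ≡ a
inc-dec zero = refl
inc-dec (suc zero) = refl
inc-dec (suc (suc zero)) = refl
inc-dec (suc (suc (suc zero))) = refl

dec²≡inc² : ∀ a → dec4 (dec4 a) ≡ inc4 (inc4 a)
dec²≡inc² zero = refl
dec²≡inc² (suc zero) = refl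
dec²≡inc² (suc (suc zero)) = refl
dec²≡inc² (suc (suc (suc zero))) = refl

inc³≡dec : ∀ a → inc4 (inc4 (inc4 a)) ≡ dec4 a
inc³≡dec zero = refl
inc³≡dec (suc zero) = refl
inc³≡dec (suc (suc zero)) = refl
inc³≡dec (suc (suc (suc zero))) = refl

inc-moves : ∀ a → inc4 a ≢ a
inc-moves zero ()
inc-moves (suc zero) ()
inc-moves (suc (suc zero)) ()
inc-moves (suc (suc (suc zero))) ()

inc²-moves : ∀ a → inc4 (inc4 a) ≢ a
inc²-moves zero ()
inc²-moves (suc zero) ()
inc²-moves (suc (suc zero)) ()
inc²-moves (suc (suc (suc zero))) ()

dec-moves : ∀ a → dec4 a ≢ a
dec-moves a e = inc-moves a (trans (cong inc4 (sym e)) (inc-dec a))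

dec²-moves : ∀ a → dec4 (dec4 a) ≢ a
dec²-moves a e = inc²-moves a (trans (sym (dec²≡inc² a)) e)

inc³-moves : ∀ a → inc4 (inc4 (inc4 a)) ≢ a
inc³-moves a e = dec-moves a (trans (sym (inc³≡dec a)) e)

dec∘inc²-moves : ∀ a → dec4 (inc4 (inc4 a)) ≢ a
dec∘inc²-moves a e = inc-moves a (trans (sym (dec-inc (inc4 a))) e)

inc∘dec²-moves : ∀ a → inc4 (dec4 (dec4 a)) ≢ a
inc∘dec²-moves a e = dec-moves a (trans (sym (inc-dec (dec4 a))) e)

data Offset (c : Fin 4) : Fin 4 → Set where
  same     : Offset c c
  ahead    : Offset c (inc4 c)
  opposite : Offset c (inc4 (inc4 c))
  behind   : Offset c (dec4 c)

offset : ∀ c e → Offset c e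
offset zero zero = same
offset zero (suc zero) = ahead
offset zero (suc (suc zero)) = opposite
offset zero (suc (suc (suc zero))) = behind
offset (suc zero) zero = behind
offset (suc zero) (suc zero) = same
offset (suc zero) (suc (suc zero)) = ahead
offset (suc zero) (suc (suc (suc zero))) = opposite
offset (suc (suc zero)) zero = opposite
offset (suc (suc zero)) (suc zero) = behind
offset (suc (suc zero)) (suc (suc zero)) = same
offset (suc (suc zero)) (suc (suc (suc zero))) = ahead
offset (suc (suc (suc zero))) zero = ahead
offset (suc (suc (suc zero))) (suc zero) = opposite
offset (suc (suc (suc zero))) (suc (suc zero)) = behind
offset (suc (suc (suc zero))) (suc (suc (suc zero))) = same

undo-inc : ∀ {m} (x : Vec (Fin 4) m) i → updateAt (updateAt x i inc4) i dec4 ≡ x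
undo-inc x i = trans (updateAt-updateAt-local i x (dec-inc _)) (updateAt-id i x)

undo-dec : ∀ {m} (x : Vec (Fin 4) m) i → updateAt (updateAt x i dec4) i inc4 ≡ x
undo-dec x i = trans (updateAt-updateAt-local i x (inc-dec _)) (updateAt-id i x)

update-moves : ∀ (f : Fin 4 → Fin 4) → (∀ a → f a ≢ a) →
               ∀ {m} (x : Vec (Fin 4) m) i → updateAt x i f ≢ x
update-moves f moves (a ∷ x) zero e = moves a (∷-injectiveˡ e)
update-moves f moves (a ∷ x) (suc i) e = update-moves f moves x i (∷-injectiveʳ e)

update-injective : ∀ (f : Fin 4 → Fin 4) → (∀ a → f a ≢ a) →
                   ∀ {m} (x : Vec (Fin 4) m) {i j} → updateAt x i f ≡ updateAt x j f → i ≡ j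
update-injective f moves (a ∷ x) {zero} {zero} e = refl
update-injective f moves (a ∷ x) {zero} {suc j} e = ⊥-elim (moves a (∷-injectiveˡ e))
update-injective f moves (a ∷ x) {suc i} {zero} e = ⊥-elim (moves a (sym (∷-injectiveˡ e)))
update-injective f moves (a ∷ x) {suc i} {suc j} e = cong suc (update-injective f moves x (∷-injectiveʳ e))

Cls : ℕ → Set
Cls m = Bool × Vec (Fin 4) m

Up : ∀ {m} → Vec (Fin 4) m → Vec (Fin 4) m → Set
Up {m} x y = y ≡ x ⊎ Σ (Fin m) (λ i → y ≡ updateAt x i inc4)

QAdj : ∀ {m} → Cls m → Cls m → Set
QAdj (false , x) (true , y) = Up x y
QAdj (true , y) (false , x) = Up x y
QAdj (false , _) (false , _) = ⊥
QAdj (true , _) (true , _) = ⊥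

qsym : ∀ {m} (X Y : Cls m) → QAdj X Y → QAdj Y X
qsym (false , x) (true , y) a = a
qsym (true , y) (false , x) a = a

qirr : ∀ {m} (X : Cls m) → ¬ QAdj X X
qirr (false , x) ()
qirr (true , x) ()

data QPath {m} (A : Cls m → Set) : Cls m → Cls m → Set where
  here : ∀ {X} → A X → QPath A X X
  step : ∀ {X Y Z} → A X → QAdj X Y → QPath A Y Z → QPath A X Z

module _ {m} {A : Cls m → Set} where

  infixr 5 _++ₚ_

  _++ₚ_ : ∀ {X Y Z} → QPath A X Y → QPath A Y Z → QPath A X Z
  here _ ++ₚ Q = Q
  step a e P ++ₚ Q = step a e (P ++ₚ Q)

  start : ∀ {X Y} → QPath A X Y → A X
  start (here a) = a
  start (step a _ _) = a

  reverse : ∀ {X Y} → QPath A X Y → QPath A Y X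
  reverse (here a) = here a
  reverse (step {X} {Y} a e P) = reverse P ++ₚ step (start P) (qsym X Y e) (here a)

Independent : ∀ {m} → Cls m → Cls m → Set
Independent X Y = X ≢ Y × ¬ QAdj X Y

Obstruction : ∀ {m} → (Cls m → Set) → ℕ → Set
Obstruction {m} A k =
  Σ (List (Cls m)) λ L → k ≤ length L × All (λ Z → ¬ A Z) L × AllPairs Independent L

ConnectsOrObstructs : ℕ → Set₁
ConnectsOrObstructs m = (A : Cls m → Set) → Decidable A →
  ∀ X Y → A X → A Y → QPath A X Y ⊎ Obstruction A (suc m)

emb : ∀ {m} → Fin 4 → Cls m → Cls (suc m)
emb c (p , x) = p , c ∷ x

copy : ∀ {m} → Cls (suc m) → Fin 4
copy (_ , c ∷ _) = c

partner : ∀ {m} → Cls (suc m) → Cls (suc m)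
partner (false , c ∷ x) = true , inc4 c ∷ x
partner (true , c ∷ x) = false , dec4 c ∷ x

partner-adj : ∀ {m} (X : Cls (suc m)) → QAdj X (partner X)
partner-adj (false , c ∷ x) = inj₂ (zero , refl)
partner-adj (true , c ∷ x) = inj₂ (zero , cong (_∷ x) (sym (inc-dec c)))

cross-adj : ∀ {m} (Z W : Cls (suc m)) → QAdj Z W → copy Z ≢ copy W → W ≡ partner Z
cross-adj (false , e ∷ x) (true , f ∷ y) (inj₁ eq) ne = ⊥-elim (ne (sym (∷-injectiveˡ eq)))
cross-adj (false , e ∷ x) (true , f ∷ y) (inj₂ (zero , eq)) ne = cong (true ,_) eq
cross-adj (false , e ∷ x) (true , f ∷ y) (inj₂ (suc i , eq)) ne = ⊥-elim (ne (sym (∷-injectiveˡ eq)))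
cross-adj (true , e ∷ y) (false , f ∷ x) (inj₁ eq) ne = ⊥-elim (ne (∷-injectiveˡ eq))
cross-adj (true , e ∷ y) (false , f ∷ x) (inj₂ (zero , refl)) ne = cong (λ d → false , d ∷ x) (sym (dec-inc f))
cross-adj (true , e ∷ y) (false , f ∷ x) (inj₂ (suc i , eq)) ne = ⊥-elim (ne (∷-injectiveˡ eq))

emb-adj : ∀ {m} c (X Y : Cls m) → QAdj X Y → QAdj (emb c X) (emb c Y)
emb-adj c (false , x) (true , y) (inj₁ e) = inj₁ (cong (c ∷_) e)
emb-adj c (false , x) (true , y) (inj₂ (i , e)) = inj₂ (suc i , cong (c ∷_) e)
emb-adj c (true , y) (false , x) (inj₁ e) = inj₁ (cong (c ∷_) e)
emb-adj c (true , y) (false , x) (inj₂ (i , e)) = inj₂ (suc i , cong (c ∷_) e)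

emb-adj⁻ : ∀ {m} c (X Y : Cls m) → QAdj (emb c X) (emb c Y) → QAdj X Y
emb-adj⁻ c (false , x) (true , y) (inj₁ e) = inj₁ (∷-injectiveʳ e)
emb-adj⁻ c (false , x) (true , y) (inj₂ (zero , e)) = ⊥-elim (inc-moves c (sym (∷-injectiveˡ e)))
emb-adj⁻ c (false , x) (true , y) (inj₂ (suc i , e)) = inj₂ (i , ∷-injectiveʳ e)
emb-adj⁻ c (true , y) (false , x) (inj₁ e) = inj₁ (∷-injectiveʳ e)
emb-adj⁻ c (true , y) (false , x) (inj₂ (zero , e)) = ⊥-elim (inc-moves c (sym (∷-injectiveˡ e)))
emb-adj⁻ c (true , y) (false , x) (inj₂ (suc i , e)) = inj₂ (i , ∷-injectiveʳ e)

emb-independent : ∀ {m} c (X Y : Cls m) → Independent X Y → Independent (emb c X) (emb c Y)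
emb-independent c (p , x) (q , y) (ne , na) =
  (λ { refl → ne refl }) , (λ a → na (emb-adj⁻ c (p , x) (q , y) a))

lift-path : ∀ {m} {A : Cls (suc m) → Set} c {X Y : Cls m} →
            QPath (A ∘ emb c) X Y → QPath A (emb c X) (emb c Y)
lift-path c (here a) = here a
lift-path c (step {X} {Y} a e P) = step a (emb-adj c X Y e) (lift-path c P)

Reaches : ∀ {m} → (Cls (suc m) → Set) → Cls (suc m) → Fin 4 → Set
Reaches {m} A W d = Σ (Cls m) λ K → A (emb d K) × QPath A W (emb d K)

record Escapee {m} (A : Cls (suc m) → Set) (c : Fin 4) : Set where
  constructor escapee
  field
    vertex : Cls (suc m)
    dead : ¬ A vertex
    outside : copy vertex ≢ c
    partner-safe : copy (partner vertex) ≢ c ⊎ A (partner vertex)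

open Escapee

escapee-independent : ∀ {m} {A : Cls (suc m) → Set} {c} (e : Escapee A c) →
                      ∀ K → ¬ A (emb c K) → Independent (vertex e) (emb c K)
escapee-independent {A = A} {c = c} e (p , x) dK = distinct , non-adjacent
  where
  distinct : vertex e ≢ (p , c ∷ x)
  distinct eq = outside e (cong copy eq)
  non-adjacent : ¬ QAdj (vertex e) (p , c ∷ x)
  non-adjacent adj with cross-adj (vertex e) (p , c ∷ x) adj (outside e) | partner-safe e
  ... | eq | inj₁ moved = moved (cong copy (sym eq))
  ... | eq | inj₂ alive = dK (subst A (sym eq) alive)

extend-in-copy : ∀ {m} {A : Cls (suc m) → Set} {c k} →
                 Obstruction (A ∘ emb c) k → Escapee A c → Obstruction A (suc k)
extend-in-copy {c = c} (J , size , dead-J , indep-J) e =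
  vertex e ∷ map (emb c) J ,
  s≤s (≤-trans size (≤-reflexive (sym (length-map (emb c) J)))) ,
  dead e ∷ Allₚ.map⁺ dead-J ,
  Allₚ.map⁺ (All.map (λ {K} → escapee-independent e K) dead-J) ∷
  AllPairsₚ.map⁺ (AllPairs.map (λ {X} {Y} → emb-independent c X Y) indep-J)

-- Every alive vertex reaches copy h in at most three steps, each step a
-- move to the other side or to the partner; a dead vertex met on the way is an
-- escapee of copy c.  Inside copy h the statement for Q_m joins the two entry
-- points, and an obstruction there contains a dead vertex of copy h, which is an
-- escapee of copy c as well.
module Hub {m} (A : Cls (suc m) → Set) (A? : Decidable A) (ih : ConnectsOrObstructs m)
           (c : Fin 4) {R : Set} (escape : Escapee A c → R) where

  open RawMonad (SumRight.monad 0ℓ R)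

  h : Fin 4
  h = inc4 (inc4 c)

  alive : ∀ Z → copy Z ≢ c → copy (partner Z) ≢ c ⊎ A (partner Z) → A Z ⊎ R
  alive Z out safe with A? Z
  ... | yes a = inj₁ a
  ... | no d = inj₂ (escape (escapee Z d out safe))

  enter-hub : ∀ {W} p x {d} → d ≡ h → A (p , d ∷ x) → QPath A W (p , d ∷ x) → Reaches A W h ⊎ R
  enter-hub p x refl a P = pure ((p , x) , a , P)

  route : ∀ p x {e} → Offset c e → A (p , e ∷ x) → Reaches A (p , e ∷ x) h ⊎ R
  route false x same aW = do
    a₁ ← alive (true , inc4 c ∷ x) (inc-moves c) (inj₂ (subst (λ d → A (false , d ∷ x)) (sym (dec-inc c)) aW))
    a₂ ← alive (false , inc4 c ∷ x) (inc-moves c) (inj₁ (inc²-moves c))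
    a₃ ← alive (true , h ∷ x) (inc²-moves c) (inj₁ (dec∘inc²-moves c))
    pure ((true , x) , a₃ , step aW (partner-adj (false , c ∷ x))
      (step a₁ (inj₁ refl) (step a₂ (partner-adj (false , inc4 c ∷ x)) (here a₃))))
  route true x same aW = do
    a₁ ← alive (false , dec4 c ∷ x) (dec-moves c) (inj₂ (subst (λ d → A (true , d ∷ x)) (sym (inc-dec c)) aW))
    a₂ ← alive (true , dec4 c ∷ x) (dec-moves c) (inj₁ (dec²-moves c))
    a₃ ← alive (false , dec4 (dec4 c) ∷ x) (dec²-moves c) (inj₁ (inc∘dec²-moves c))
    enter-hub false x (dec²≡inc² c) a₃
      (step aW (partner-adj (true , c ∷ x))
        (step a₁ (inj₁ refl) (step a₂ (partner-adj (true , dec4 c ∷ x)) (here a₃))))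
  route false x ahead aW = do
    a₁ ← alive (true , h ∷ x) (inc²-moves c) (inj₁ (dec∘inc²-moves c))
    pure ((true , x) , a₁ , step aW (partner-adj (false , inc4 c ∷ x)) (here a₁))
  route true x ahead aW = do
    a₁ ← alive (false , inc4 c ∷ x) (inc-moves c) (inj₁ (inc²-moves c))
    a₂ ← alive (true , h ∷ x) (inc²-moves c) (inj₁ (dec∘inc²-moves c))
    pure ((true , x) , a₂ , step aW (inj₁ refl) (step a₁ (partner-adj (false , inc4 c ∷ x)) (here a₂)))
  route p x opposite aW = pure ((p , x) , aW , here aW)
  route false x behind aW = do
    a₁ ← alive (true , dec4 c ∷ x) (dec-moves c) (inj₁ (dec²-moves c))
    a₂ ← alive (false , dec4 (dec4 c) ∷ x) (dec²-moves c) (inj₁ (inc∘dec²-moves c))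
    enter-hub false x (dec²≡inc² c) a₂ (step aW (inj₁ refl) (step a₁ (partner-adj (true , dec4 c ∷ x)) (here a₂)))
  route true x behind aW = do
    a₁ ← alive (false , dec4 (dec4 c) ∷ x) (dec²-moves c) (inj₁ (inc∘dec²-moves c))
    enter-hub false x (dec²≡inc² c) a₁ (step aW (partner-adj (true , dec4 c ∷ x)) (here a₁))

  reach-hub : ∀ W → A W → Reaches A W h ⊎ R
  reach-hub (p , e ∷ x) = route p x (offset c e)

  hub-escapee : Obstruction (A ∘ emb h) (suc m) → Escapee A c
  hub-escapee ((false , x) ∷ _ , _ , d ∷ _ , _) = escapee (false , h ∷ x) d (inc²-moves c) (inj₁ (inc³-moves c))
  hub-escapee ((true , x) ∷ _ , _ , d ∷ _ , _) = escapee (true , h ∷ x) d (inc²-moves c) (inj₁ (dec∘inc²-moves c))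

  connect : ∀ {X Y} → A X → A Y → QPath A X Y ⊎ R
  connect {X} {Y} aX aY = do
    (K₁ , a₁ , P₁) ← reach-hub X aX
    (K₂ , a₂ , P₂) ← reach-hub Y aY
    Q ← map₂ (escape ∘ hub-escapee) (ih (A ∘ emb h) (A? ∘ emb h) K₁ K₂ a₁ a₂)
    pure (P₁ ++ₚ lift-path h Q ++ₚ reverse P₂)

-- Q_0 is a single edge.
connects-or-obstructs-0 : ConnectsOrObstructs 0
connects-or-obstructs-0 A A? (false , []) (false , []) aX aY = inj₁ (here aX)
connects-or-obstructs-0 A A? (true , []) (true , []) aX aY = inj₁ (here aX)
connects-or-obstructs-0 A A? (false , []) (true , []) aX aY = inj₁ (step aX (inj₁ refl) (here aY))
connects-or-obstructs-0 A A? (true , []) (false , []) aX aY = inj₁ (step aX (inj₁ refl) (here aY))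

-- Routing through the hub of copy 0 joins X and Y or finds an
-- escapee Z₀; routing through the hub of the copy of Z₀ then joins them or finds
-- an escapee of that copy, which is independent of Z₀.
connects-or-obstructs-1 : ConnectsOrObstructs 1
connects-or-obstructs-1 A A? X Y aX aY =
  [ inj₁ , id ]′ (Hub.connect A A? connects-or-obstructs-0 zero second aX aY)
  where
  second : Escapee A zero → QPath A X Y ⊎ Obstruction A 2
  second (escapee (p , c ∷ []) d₀ _ _) = Hub.connect A A? connects-or-obstructs-0 c pair aX aY
    where
    pair : Escapee A c → Obstruction A 2
    pair e = vertex e ∷ (p , c ∷ []) ∷ [] , ≤-refl , dead e ∷ d₀ ∷ [] ,
             (escapee-independent e (p , []) d₀ ∷ []) ∷ [] ∷ []

positions : ∀ m → List (Vec (Fin 4) (suc m))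
positions zero = (zero ∷ []) ∷ (suc zero ∷ []) ∷ (suc (suc zero) ∷ []) ∷ []
positions (suc m) = (suc zero ∷ replicate (suc m) zero) ∷ map (zero ∷_) (positions m)

positions-length : ∀ m → length (positions m) ≡ suc (suc (suc m))
positions-length zero = refl
positions-length (suc m) = cong suc (trans (length-map (zero ∷_) (positions m)) (positions-length m))

positions-unique : ∀ m → Unique (positions m)
positions-unique zero = ((λ ()) ∷ (λ ()) ∷ []) ∷ ((λ ()) ∷ []) ∷ [] ∷ []
positions-unique (suc m) =
  Allₚ.map⁺ (All.universal (λ _ ()) (positions m)) ∷
  AllPairsₚ.map⁺ (AllPairs.map (λ ne e → ne (∷-injectiveʳ e)) (positions-unique m))

-- Walking from the copy of X to the copy of Y, the matching between consecutive
-- copies is crossed at one of m + 3 positions; if every such cross edge has a dead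
-- end, these ends form an obstruction.  An obstruction of size m + 2 inside a single
-- copy is completed by an escapee found through the hub.
module Step {m} (A : Cls (suc (suc m)) → Set) (A? : Decidable A) (ih : ConnectsOrObstructs (suc m)) where

  data Failure : Set where
    global : Obstruction A (suc (suc (suc m))) → Failure
    in-copy : ∀ c → Obstruction (A ∘ emb c) (suc (suc m)) → Failure

  open RawMonad (SumRight.monad 0ℓ Failure)

  Position : Set
  Position = Vec (Fin 4) (suc m)

  end : Fin 4 → Position × Bool → Cls (suc (suc m))
  end c (v , false) = false , c ∷ v
  end c (v , true) = true , inc4 c ∷ v

  ends-independent : ∀ c (p q : Position × Bool) → proj₁ p ≢ proj₁ q → Independent (end c p) (end c q)
  ends-independent c (v , false) (w , false) ne = (λ e → ne (∷-injectiveʳ (cong proj₂ e))) , (λ ())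
  ends-independent c (v , true) (w , true) ne = (λ e → ne (∷-injectiveʳ (cong proj₂ e))) , (λ ())
  ends-independent c (v , false) (w , true) ne = (λ ()) , crossing v w ne
    where
    crossing : ∀ v w → v ≢ w → ¬ Up (c ∷ v) (inc4 c ∷ w)
    crossing v w ne (inj₁ e) = inc-moves c (∷-injectiveˡ e)
    crossing v w ne (inj₂ (zero , e)) = ne (sym (∷-injectiveʳ e))
    crossing v w ne (inj₂ (suc i , e)) = inc-moves c (∷-injectiveˡ e)
  ends-independent c (v , true) (w , false) ne =
    (λ ()) , proj₂ (ends-independent c (w , false) (v , true) (ne ∘ sym))

  AliveCrossing : Fin 4 → List Position → Set
  AliveCrossing c vs =
    Σ Position (λ v → A (false , c ∷ v) × A (true , inc4 c ∷ v))
    ⊎ Σ (List (Position × Bool)) (λ E → map proj₁ E ≡ vs × All (λ q → ¬ A (end c q)) E)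

  scan : ∀ c vs → AliveCrossing c vs
  scan c [] = inj₂ ([] , refl , [])
  scan c (v ∷ vs) with A? (false , c ∷ v) | A? (true , inc4 c ∷ v) | scan c vs
  ... | yes a | yes b | _ = inj₁ (v , a , b)
  ... | _ | _ | inj₁ crossing = inj₁ crossing
  ... | no d | _ | inj₂ (E , pos , dead-E) = inj₂ ((v , false) ∷ E , cong (v ∷_) pos , d ∷ dead-E)
  ... | yes _ | no d | inj₂ (E , pos , dead-E) = inj₂ ((v , true) ∷ E , cong (v ∷_) pos , d ∷ dead-E)

  dead-ends-obstruct : ∀ c (E : List (Position × Bool)) → map proj₁ E ≡ positions m →
                       All (λ q → ¬ A (end c q)) E → Obstruction A (suc (suc (suc m)))
  dead-ends-obstruct c E pos dead-E =
    map (end c) E ,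
    ≤-reflexive (sym (trans (length-map (end c) E)
      (trans (sym (length-map proj₁ E)) (trans (cong length pos) (positions-length m))))) ,
    Allₚ.map⁺ dead-E ,
    AllPairsₚ.map⁺ (AllPairs.map (λ {p} {q} → ends-independent c p q)
      (AllPairsₚ.map⁻ (subst Unique (sym pos) (positions-unique m))))

  advance : ∀ {W} c → Reaches A W c → Reaches A W (inc4 c) ⊎ Failure
  advance c (K , aK , P) with scan c (positions m)
  ... | inj₂ (E , pos , dead-E) = inj₂ (global (dead-ends-obstruct c E pos dead-E))
  ... | inj₁ (v , a₀ , a₁) = do
    Q ← map₂ (in-copy c) (ih (A ∘ emb c) (A? ∘ emb c) K (false , v) aK a₀)
    pure ((true , v) , a₁ , P ++ₚ lift-path c Q ++ₚ step a₀ (partner-adj (false , c ∷ v)) (here a₁))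

  reach : ∀ {W c d} → Offset c d → Reaches A W c → Reaches A W d ⊎ Failure
  reach same r = pure r
  reach {c = c} ahead r = advance c r
  reach {c = c} opposite r = advance c r >>= advance (inc4 c)
  reach {W} {c} behind r = do
    r₃ ← advance c r >>= advance (inc4 c) >>= advance (inc4 (inc4 c))
    pure (subst (Reaches A W) (inc³≡dec c) r₃)

  connect-or-fail : ∀ X Y → A X → A Y → QPath A X Y ⊎ Failure
  connect-or-fail (p , c ∷ x) (q , d ∷ y) aX aY = do
    (K , aK , P) ← reach (offset c d) ((p , x) , aX , here aX)
    Q ← map₂ (in-copy d) (ih (A ∘ emb d) (A? ∘ emb d) K (q , y) aK aY)
    pure (P ++ₚ lift-path d Q)

  connect : ∀ X Y → A X → A Y → QPath A X Y ⊎ Obstruction A (suc (suc (suc m)))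
  connect X Y aX aY with connect-or-fail X Y aX aY
  ... | inj₁ P = inj₁ P
  ... | inj₂ (global O) = inj₂ O
  ... | inj₂ (in-copy c J) = Hub.connect A A? ih c (extend-in-copy J) aX aY

connects-or-obstructs : ∀ m → ConnectsOrObstructs m
connects-or-obstructs zero = connects-or-obstructs-0
connects-or-obstructs (suc zero) = connects-or-obstructs-1
connects-or-obstructs (suc (suc m)) A A? = Step.connect A A? (connects-or-obstructs (suc m))

parity : Fin 4 → Bool
parity zero = false
parity (suc zero) = true
parity (suc (suc zero)) = false
parity (suc (suc (suc zero))) = true

half : Fin 4 → Bool
half zero = false
half (suc zero) = false
half (suc (suc zero)) = true
half (suc (suc (suc zero))) = true

digit : Bool → Bool → Fin 4
digit false false = zero
digit true false = suc zero
digit false true = suc (suc zero)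
digit true true = suc (suc (suc zero))

cls : ∀ {m} → Vtx (suc m) → Cls m
cls (a ∷ x) = parity a , x

twin : ∀ {m} → Cls m → Bool → Vtx (suc m)
twin (p , x) t = digit p t ∷ x

cls-twin : ∀ {m} (X : Cls m) t → cls (twin X t) ≡ X
cls-twin (false , x) false = refl
cls-twin (false , x) true = refl
cls-twin (true , x) false = refl
cls-twin (true , x) true = refl

twin-cls : ∀ {m} (u : Vtx (suc m)) → twin (cls u) (half (head u)) ≡ u
twin-cls (zero ∷ x) = refl
twin-cls (suc zero ∷ x) = refl
twin-cls (suc (suc zero) ∷ x) = refl
twin-cls (suc (suc (suc zero)) ∷ x) = refl

-- For an odd leading digit the tail moves down (y = x or y = x - eᵢ), which is
-- the upward relation read backwards.

up-of-down : ∀ {m} (x y : Vec (Fin 4) m) →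
             (y ≡ x ⊎ Σ (Fin m) (λ i → y ≡ updateAt x i dec4)) → Up y x
up-of-down x y (inj₁ e) = inj₁ (sym e)
up-of-down x y (inj₂ (i , e)) = inj₂ (i , sym (trans (cong (λ z → updateAt z i inc4) e) (undo-dec x i)))

down-of-up : ∀ {m} (x y : Vec (Fin 4) m) →
             Up y x → (y ≡ x ⊎ Σ (Fin m) (λ i → y ≡ updateAt x i dec4))
down-of-up x y (inj₁ e) = inj₁ (sym e)
down-of-up x y (inj₂ (i , e)) = inj₂ (i , sym (trans (cong (λ z → updateAt z i dec4) e) (undo-inc y i)))

adj-cls : ∀ {m} (u v : Vtx (suc m)) → BHAdj u v → QAdj (cls u) (cls v)
adj-cls (zero ∷ x) (b ∷ y) (inj₁ refl , s) = s
adj-cls (zero ∷ x) (b ∷ y) (inj₂ refl , s) = s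
adj-cls (suc (suc zero) ∷ x) (b ∷ y) (inj₁ refl , s) = s
adj-cls (suc (suc zero) ∷ x) (b ∷ y) (inj₂ refl , s) = s
adj-cls (suc zero ∷ x) (b ∷ y) (inj₁ refl , s) = up-of-down x y s
adj-cls (suc zero ∷ x) (b ∷ y) (inj₂ refl , s) = up-of-down x y s
adj-cls (suc (suc (suc zero)) ∷ x) (b ∷ y) (inj₁ refl , s) = up-of-down x y s
adj-cls (suc (suc (suc zero)) ∷ x) (b ∷ y) (inj₂ refl , s) = up-of-down x y s

cls-adj : ∀ {m} (u v : Vtx (suc m)) → QAdj (cls u) (cls v) → BHAdj u v
cls-adj (zero ∷ x) (suc zero ∷ y) q = inj₁ refl , q
cls-adj (zero ∷ x) (suc (suc (suc zero)) ∷ y) q = inj₂ refl , q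
cls-adj (suc (suc zero) ∷ x) (suc zero ∷ y) q = inj₂ refl , q
cls-adj (suc (suc zero) ∷ x) (suc (suc (suc zero)) ∷ y) q = inj₁ refl , q
cls-adj (suc zero ∷ x) (zero ∷ y) q = inj₂ refl , down-of-up x y q
cls-adj (suc zero ∷ x) (suc (suc zero) ∷ y) q = inj₁ refl , down-of-up x y q
cls-adj (suc (suc (suc zero)) ∷ x) (zero ∷ y) q = inj₁ refl , down-of-up x y q
cls-adj (suc (suc (suc zero)) ∷ x) (suc (suc zero) ∷ y) q = inj₂ refl , down-of-up x y q
cls-adj (suc zero ∷ x) (suc (suc (suc zero)) ∷ y) ()
cls-adj (suc (suc (suc zero)) ∷ x) (suc (suc (suc zero)) ∷ y) ()

nbhd : ∀ {m} → Cls m → List (Cls m)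
nbhd (false , x) = (true , x) ∷ tabulate (λ i → true , updateAt x i inc4)
nbhd (true , y) = (false , y) ∷ tabulate (λ i → false , updateAt y i dec4)

nbhd-length : ∀ {m} (X : Cls m) → length (nbhd X) ≡ suc m
nbhd-length (false , x) = cong suc (length-tabulate _)
nbhd-length (true , y) = cong suc (length-tabulate _)

nbhd-adj : ∀ {m} (X : Cls m) → All (QAdj X) (nbhd X)
nbhd-adj (false , x) = inj₁ refl ∷ Allₚ.tabulate⁺ (λ i → inj₂ (i , refl))
nbhd-adj (true , y) = inj₁ refl ∷ Allₚ.tabulate⁺ (λ i → inj₂ (i , sym (undo-dec y i)))

nbhd-complete : ∀ {m} (X Y : Cls m) → QAdj X Y → Y ∈ nbhd X
nbhd-complete (false , x) (true , y) (inj₁ e) = here (cong (true ,_) e)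
nbhd-complete (false , x) (true , y) (inj₂ (i , e)) =
  there (subst (_∈ tabulate (λ j → true , updateAt x j inc4)) (cong (true ,_) (sym e)) (∈-tabulate⁺ i))
nbhd-complete (true , y) (false , x) (inj₁ e) = here (cong (false ,_) (sym e))
nbhd-complete (true , y) (false , x) (inj₂ (i , e)) =
  there (subst (_∈ tabulate (λ j → false , updateAt y j dec4))
    (cong (false ,_) (trans (cong (λ z → updateAt z i dec4) e) (undo-inc x i))) (∈-tabulate⁺ i))

nbhd-independent : ∀ {m} (X : Cls m) → AllPairs Independent (nbhd X)
nbhd-independent (false , x) =
  Allₚ.tabulate⁺ (λ i → (λ e → update-moves inc4 inc-moves x i (sym (cong proj₂ e))) , λ ()) ∷
  AllPairsₚ.tabulate⁺ (λ ne → (λ e → ne (update-injective inc4 inc-moves x (cong proj₂ e))) , λ ())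
nbhd-independent (true , y) =
  Allₚ.tabulate⁺ (λ i → (λ e → update-moves dec4 dec-moves y i (sym (cong proj₂ e))) , λ ()) ∷
  AllPairsₚ.tabulate⁺ (λ ne → (λ e → ne (update-injective dec4 dec-moves y (cong proj₂ e))) , λ ())

Separated : ∀ {n} → Vtx n → Vtx n → Set
Separated a b = ∀ P → a ∈P P → b ∈P P → ⊥

separated : ∀ {m} {a b : Vtx (suc m)} → a ≢ b → ¬ QAdj (cls a) (cls b) → Separated a b
separated ne na (vtx v) refl refl = ne refl
separated ne na (edg u v adj) (inj₁ refl) (inj₁ refl) = ne refl
separated ne na (edg u v adj) (inj₁ refl) (inj₂ refl) = na (adj-cls u v adj)
separated ne na (edg u v adj) (inj₂ refl) (inj₁ refl) = na (qsym _ _ (adj-cls u v adj))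
separated ne na (edg u v adj) (inj₂ refl) (inj₂ refl) = ne refl

─-keeps : ∀ {n} {a b : Vtx n} (F : List (Piece n)) (pa : Any (a ∈P_) F) →
          Any (b ∈P_) F → Separated a b → Any (b ∈P_) (F ─ pa)
─-keeps (P ∷ F) (here a∈P) (here b∈P) sep = ⊥-elim (sep P a∈P b∈P)
─-keeps (P ∷ F) (here _) (there pb) _ = pb
─-keeps (P ∷ F) (there _) (here b∈P) _ = here b∈P
─-keeps (P ∷ F) (there pa) (there pb) sep = there (─-keeps F pa pb sep)

separated-≤ : ∀ {n} (L : List (Vtx n)) (F : List (Piece n)) →
              All (InVF F) L → AllPairs Separated L → length L ≤ length F
separated-≤ [] F _ _ = z≤n
separated-≤ (a ∷ L) F (pa ∷ covered) (sep ∷ seps) =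
  subst (suc (length L) ≤_) (sym (length-removeAt′ F (index pa)))
    (s≤s (separated-≤ L (F ─ pa) (All.zipWith (λ (pb , s) → ─-keeps F pa pb s) (covered , sep)) seps))

twins-differ : ∀ {m} (X : Cls m) → twin X false ≢ twin X true
twins-differ (false , _) ()
twins-differ (true , _) ()

twins : ∀ {m} → List (Cls m) → List (Vtx (suc m))
twins [] = []
twins (X ∷ L) = twin X false ∷ twin X true ∷ twins L

twins-length : ∀ {m} (L : List (Cls m)) → length (twins L) ≡ 2 * length L
twins-length [] = refl
twins-length (X ∷ L) = trans (cong (λ (k : ℕ) → suc (suc k)) (twins-length L)) (sym (*-suc 2 (length L)))

twins-all : ∀ {m} {P : Vtx (suc m) → Set} {L : List (Cls m)} →
            All (λ Y → ∀ t → P (twin Y t)) L → All P (twins L)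
twins-all [] = []
twins-all (p ∷ ps) = p false ∷ p true ∷ twins-all ps

twins-separated : ∀ {m} {L : List (Cls m)} → AllPairs Independent L → AllPairs Separated (twins L)
twins-separated [] = []
twins-separated {L = X ∷ L} (indep-X ∷ indep-L) =
  (same-class ∷ twins-all (All.map (λ i t → other-class i false t) indep-X)) ∷
  twins-all (All.map (λ i t → other-class i true t) indep-X) ∷ twins-separated indep-L
  where
  same-class : Separated (twin X false) (twin X true)
  same-class = separated (twins-differ X) (λ a → qirr X (subst₂ QAdj (cls-twin X false) (cls-twin X true) a))
  other-class : ∀ {Y} → Independent X Y → ∀ t t′ → Separated (twin X t) (twin Y t′)
  other-class {Y} (ne , na) t t′ = separated
    (λ e → ne (trans (sym (cls-twin X t)) (trans (cong cls e) (cls-twin Y t′))))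
    (λ a → na (subst₂ QAdj (cls-twin X t) (cls-twin Y t′) a))

twins-sound : ∀ {m} {u : Vtx (suc m)} (L : List (Cls m)) → u ∈ twins L → cls u ∈ L
twins-sound (X ∷ L) (here e) = here (trans (cong cls e) (cls-twin X false))
twins-sound (X ∷ L) (there (here e)) = here (trans (cong cls e) (cls-twin X true))
twins-sound (X ∷ L) (there (there p)) = there (twins-sound L p)

twins-complete : ∀ {m} {Y : Cls m} (L : List (Cls m)) → Y ∈ L → ∀ t → twin Y t ∈ twins L
twins-complete (X ∷ L) (here refl) false = here refl
twins-complete (X ∷ L) (here refl) true = there (here refl)
twins-complete (X ∷ L) (there p) t = there (there (twins-complete L p t))

covered? : ∀ {n} (F : List (Piece n)) → Decidable (InVF F)
covered? F x = any? (x ∈P?_) F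
  where
  _∈P?_ : ∀ {n} (x : Vtx n) (P : Piece n) → Dec (x ∈P P)
  x ∈P? vtx v = ≡-dec _≟ᶠ_ x v
  x ∈P? edg u v _ = ≡-dec _≟ᶠ_ x u ⊎-dec ≡-dec _≟ᶠ_ x v

Alive : ∀ {m} → List (Piece (suc m)) → Cls m → Set
Alive F X = Σ Bool λ t → Remains F (twin X t)

alive? : ∀ {m} (F : List (Piece (suc m))) → Decidable (Alive F)
alive? F X = map′ (λ { (inj₁ r) → false , r ; (inj₂ r) → true , r })
                  (λ { (false , r) → inj₁ r ; (true , r) → inj₂ r })
                  (¬? (covered? F (twin X false)) ⊎-dec ¬? (covered? F (twin X true)))

alive-cls : ∀ {m} {F : List (Piece (suc m))} {u} → Remains F u → Alive F (cls u)
alive-cls {F = F} {u} r = half (head u) , subst (Remains F) (sym (twin-cls u)) r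

-- Both twins of a dead class are covered, so an obstruction of size k to the
-- alive classes gives 2k pairwise separated vertices of V(F).
obstruction-bound : ∀ {m k} (F : List (Piece (suc m))) → Obstruction (Alive F) k → 2 * k ≤ length F
obstruction-bound F (L , size , dead , indep) =
  ≤-trans (*-monoʳ-≤ 2 size)
    (≤-trans (≤-reflexive (sym (twins-length L)))
      (separated-≤ (twins L) F (twins-all (All.map dead-twins-covered dead)) (twins-separated indep)))
  where
  dead-twins-covered : ∀ {X} → ¬ Alive F X → ∀ t → InVF F (twin X t)
  dead-twins-covered d t = decidable-stable (covered? F _) (λ r → d (t , r))

module SmallFamily {m} (F : List (Piece (suc m))) (small : length F < 2 * suc m) where

  unobstructed : ¬ Obstruction (Alive F) (suc m)
  unobstructed O = <⇒≱ small (obstruction-bound F O)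

  -- otherwise the neighbourhood of X would be an obstruction
  alive-neighbour : ∀ X → Σ (Cls m) λ Y → QAdj X Y × Alive F Y
  alive-neighbour X with any? (alive? F) (nbhd X)
  ... | yes i = Any.lookup i , All.lookupAny (nbhd-adj X) i
  ... | no none = ⊥-elim (unobstructed
    (nbhd X , ≤-reflexive (sym (nbhd-length X)) , Allₚ.¬Any⇒All¬ (nbhd X) none , nbhd-independent X))

  -- surviving vertices of the same class are joined through an alive neighbouring class
  same-class-joined : ∀ u w → cls u ≡ cls w → Remains F u → Remains F w → Path F u w
  same-class-joined u w same-cls ru rw with alive-neighbour (cls u)
  ... | Y , adj , t , r = step ru (cls-adj u (twin Y t) to-Y) (step r (cls-adj (twin Y t) w from-Y) (here rw))
    where
    to-Y : QAdj (cls u) (cls (twin Y t))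
    to-Y = subst (QAdj (cls u)) (sym (cls-twin Y t)) adj
    from-Y : QAdj (cls (twin Y t)) (cls w)
    from-Y = subst₂ QAdj (sym (cls-twin Y t)) same-cls (qsym (cls u) Y adj)

  lift : ∀ {X Y} → QPath (Alive F) X Y → ∀ u w → cls u ≡ X → cls w ≡ Y →
         Remains F u → Remains F w → Path F u w
  lift (here _) u w eu ew ru rw = same-class-joined u w (trans eu (sym ew)) ru rw
  lift (step {Y = X′} _ adj P) u w eu ew ru rw with start P
  ... | t , r = step ru (cls-adj u (twin X′ t) (subst₂ QAdj (sym eu) (sym (cls-twin X′ t)) adj))
                  (lift P (twin X′ t) w (cls-twin X′ t) ew r rw)

  connected : ∀ u w → Remains F u → Remains F w → Path F u w
  connected u w ru rw
    with connects-or-obstructs m (Alive F) (alive? F) (cls u) (cls w) (alive-cls ru) (alive-cls rw)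
  ... | inj₁ P = lift P u w refl refl ru rw
  ... | inj₂ O = ⊥-elim (unobstructed O)

  -- starting from any class, two adjacent alive classes exist, and surviving
  -- twins of them are distinct
  nontrivial : ¬ (∀ x y → Remains F x → Remains F y → x ≡ y)
  nontrivial trivial with alive-neighbour (false , replicate m zero)
  ... | Y₁ , _ , t₁ , r₁ with alive-neighbour Y₁
  ...   | Y₂ , adj , t₂ , r₂ = qirr Y₁ (subst (QAdj Y₁) (sym Y₁≡Y₂) adj)
    where
    Y₁≡Y₂ : Y₁ ≡ Y₂
    Y₁≡Y₂ = trans (sym (cls-twin Y₁ t₁)) (trans (cong cls (trivial _ _ r₁ r₂)) (cls-twin Y₂ t₂))

  not-cut : ¬ IsCut F
  not-cut (inj₁ trivial) = nontrivial trivial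
  not-cut (inj₂ (x , y , rx , ry , no-path)) = no-path (connected x y rx ry)

lower-bound : ∀ {m} (F : List (Piece (suc m))) → IsCut F → 2 * suc m ≤ length F
lower-bound F cut = decidable-stable (_ ≤? _) (λ ¬big → SmallFamily.not-cut F (≰⇒> ¬big) cut)

module NeighbourhoodCut {m} (X : Cls m) where

  F₀ : List (Piece (suc m))
  F₀ = map vtx (twins (nbhd X))

  size : length F₀ ≡ 2 * suc m
  size = trans (length-map vtx (twins (nbhd X))) (trans (twins-length (nbhd X)) (cong (2 *_) (nbhd-length X)))

  distinct : Distinct F₀
  distinct = AllPairsₚ.map⁺ (AllPairs.map (λ {a} {b} sep same-piece →
    sep (vtx a) refl (Equivalence.from (same-piece b) refl)) (twins-separated (nbhd-independent X)))

  covers-neighbours : ∀ v → QAdj X (cls v) → InVF F₀ v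
  covers-neighbours v adj = Anyₚ.map⁺
    (subst (_∈ twins (nbhd X)) (twin-cls v) (twins-complete (nbhd X) (nbhd-complete X (cls v) adj) (half (head v))))

  -- the twins of X are not neighbours of X, so they survive
  twin-remains : ∀ t → Remains F₀ (twin X t)
  twin-remains t c = qirr X (subst (QAdj X) (cls-twin X t)
    (All.lookup (nbhd-adj X) (twins-sound (nbhd X) (Anyₚ.map⁻ c))))

  -- every neighbour of a twin x of X is covered, so no path leaves x
  no-escape : ∀ {x y} → cls x ≡ X → x ≢ y → ¬ Path F₀ x y
  no-escape _ x≢y (here _) = x≢y refl
  no-escape {x} cls-x _ (step {y = v} _ adj P) =
    path-start P (covers-neighbours v (subst (λ Z → QAdj Z (cls v)) cls-x (adj-cls x v adj)))
    where
    path-start : ∀ {x y} → Path F₀ x y → Remains F₀ x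
    path-start (here r) = r
    path-start (step r _ _) = r

  is-cut : IsK11Cut F₀
  is-cut = distinct , inj₂ (twin X false , twin X true , twin-remains false , twin-remains true ,
    no-escape (cls-twin X false) (twins-differ X))

theorem2 : (n : ℕ) → 2 ≤ n → KappaS-K11 n (2 * n)
theorem2 (suc m) _ = (F₀ , is-cut , size) , (λ F (_ , cut) → lower-bound F cut)
  where open NeighbourhoodCut (false , replicate m zero)
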